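{- Let $h:\Sigma_4^*\to\Sigma_4^*$ (with $\Sigma_4=\{0,1,2,3\}$) be the morphism $h(0)=012$, $h(1)=302$, $h(2)=031$, $h(3)=321$, and let $g_1,g_2:\Sigma_4^*\to\{0,1\}^*$ be the morphisms $g_1(0)=001$, $g_1(1)=101$, $g_1(2)=010$, $g_1(3)=110$ and $g_2(0)=010$, $g_2(1)=100$, $g_2(2)=011$, $g_2(3)=101$. Then neither $g_1(h^\omega(0))$ nor $g_2(h^\omega(0))$ contains a square $yy$ with $|y|\ge 4$.
   Context: $h^\omega(0)=\lim_n h^n(0)$ is the fixed point of $h$ starting with $0$. A square is a nonempty word $yy$ occurring as a contiguous subword. -}

module Defs where

open import Data.Nat using (ℕ; zero; suc; _+_; _<_; _≤_)
open import Data.Fin using (Fin; zero; suc)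
open import Data.List using (List; []; _∷_; concatMap)
open import Data.Product using (∃; _×_)
open import Relation.Nullary using (¬_)
open import Relation.Binary.PropositionalEquality using (_≡_)
open import Function using (_∘_)

Σ₄ : Set
Σ₄ = Fin 4

Bin : Set
Bin = Fin 2

pattern a0 = zero
pattern a1 = suc zero
pattern a2 = suc (suc zero)
pattern a3 = suc (suc (suc zero))

hL : Σ₄ → List Σ₄
hL a0 = a0 ∷ a1 ∷ a2 ∷ []
hL a1 = a3 ∷ a0 ∷ a2 ∷ []
hL a2 = a0 ∷ a3 ∷ a1 ∷ []
hL a3 = a3 ∷ a2 ∷ a1 ∷ []

pattern b0 = zero
pattern b1 = suc zero

g₁L : Σ₄ → List Bin
g₁L a0 = b0 ∷ b0 ∷ b1 ∷ []
g₁L a1 = b1 ∷ b0 ∷ b1 ∷ []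
g₁L a2 = b0 ∷ b1 ∷ b0 ∷ []
g₁L a3 = b1 ∷ b1 ∷ b0 ∷ []

g₂L : Σ₄ → List Bin
g₂L a0 = b0 ∷ b1 ∷ b0 ∷ []
g₂L a1 = b1 ∷ b0 ∷ b0 ∷ []
g₂L a2 = b0 ∷ b1 ∷ b1 ∷ []
g₂L a3 = b1 ∷ b0 ∷ b1 ∷ []

morph : {A B : Set} → (A → List B) → List A → List B
morph f = concatMap f

hIter : ℕ → List Σ₄
hIter zero = a0 ∷ []
hIter (suc k) = morph hL (hIter k)

-- total lookup with default (only used at indices within range)
at : {A : Set} → A → List A → ℕ → A
at d [] _ = d
at d (x ∷ xs) zero = x
at d (x ∷ xs) (suc n) = at d xs n

-- h^ω(0): the n-th letter is the n-th letter of h^(n+1)(0), whose length 3^(n+1) > n;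
-- since h(0) begins with 0, each h^k(0) is a prefix of h^(k+1)(0), so this is the limit.
hω : ℕ → Σ₄
hω n = at a0 (hIter (suc n)) n

-- g(h^ω(0)): the n-th letter is the n-th letter of g(h^(n+1)(0)) (length 3^(n+2) > n)
gImage : (Σ₄ → List Bin) → ℕ → Bin
gImage g n = at b0 (morph g (hIter (suc n))) n

SquareAt : {A : Set} → (ℕ → A) → ℕ → ℕ → Set
SquareAt w i ℓ = ∀ j → j < ℓ → w (i + j) ≡ w (i + ℓ + j)

HasLongSquare : {A : Set} → (ℕ → A) → Set
HasLongSquare w = ∃ λ i → ∃ λ ℓ → 4 ≤ ℓ × SquareAt w i ℓ

{-# OPTIONS --safe #-}
-- The fixed point hω = h^ω(0) is its own image under the 3-uniform injective morphism h,
-- and g(hω) is the image of hω under the 3-uniform injective coding g.  Both words are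
-- synchronizing: a factor of length 2 of hω, resp. of length 9 of g(hω), determines its
-- position modulo 3.  So a square in g(hω) with period at least 9 has period 3m, and cutting
-- it into blocks yields a near-square of period m ≥ 3 in hω.  The same desubstitution shows
-- that hω has no near-square of period ≥ 3 as soon as it has none of period 3, …, 8.  The
-- remaining short periods are finite checks on the 44 factors of length 6 of hω: every
-- factor of length 16 of hω or of g(hω) lies in the image of one of them.
module Submission where

open import Defs
open import Data.Fin using (Fin)
import Data.Fin.Properties as Fin
open import Data.List using (List; []; _∷_; _++_; concatMap; length; applyUpTo)
open import Data.List.Properties using (length-++; length-applyUpTo; concatMap-++; ≡-dec)
import Data.List.Relation.Unary.All as All
open All using (All)
open import Data.List.Membership.Propositional using (_∈_)
import Data.List.Membership.DecPropositional as DecMembership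
import Data.Nat as ℕ
open ℕ using (ℕ; zero; suc; _+_; _*_; _<_; _≤_; z≤n; s≤s; s≤s⁻¹; pred; _%_; _/_;
              NonZero; >-nonZero; >-nonZero⁻¹)
open import Data.Nat.Properties
open import Data.Nat.DivMod using (m≡m%n+[m/n]*n; m%n<n; m/n<m)
open import Data.Nat.Divisibility using (_∣_; divides; ∣m+n∣m⇒∣n; n∣m*n)
open import Data.Nat.Induction using (<-rec)
open import Data.Nat.Tactic.RingSolver using (solve)
open import Data.Product using (∃-syntax; _×_; _,_)
open import Data.Sum using (inj₁; inj₂)
open import Function.Definitions using (Injective)
open import Relation.Binary.Definitions using (DecidableEquality)
open import Relation.Binary.PropositionalEquality
open import Relation.Nullary using (¬_; Dec; yes; no; ¬?)
open import Relation.Nullary.Decidable using (map′; _→-dec_; from-yes)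

below? : ∀ {P : ℕ → Set} → (∀ j → Dec (P j)) → ∀ n → Dec (∀ j → j < n → P j)
below? P? n = map′ (λ all j → all {j}) (λ all {j} → all j) (allUpTo? P? n)

uniform? : ∀ {n} {B : Set} (f : Fin n → List B) k → Dec (∀ a → length (f a) ≡ k)
uniform? f k = Fin.all? λ a → length (f a) ℕ.≟ k

injective? : ∀ {n} {B : Set} → DecidableEquality B → (f : Fin n → B) →
             Dec (Injective _≡_ _≡_ f)
injective? _≟_ f = map′ (λ inj → inj _ _) (λ inj _ _ → inj)
  (Fin.all? λ a → Fin.all? λ b → f a ≟ f b →-dec a Fin.≟ b)

module _ {A : Set} where

  at-++ˡ : ∀ (d : A) xs {ys n} → n < length xs → at d (xs ++ ys) n ≡ at d xs n
  at-++ˡ d (x ∷ xs) {n = zero}  _         = refl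
  at-++ˡ d (x ∷ xs) {n = suc n} (s≤s n<l) = at-++ˡ d xs n<l

  at-++ʳ : ∀ (d : A) xs {ys} n → at d (xs ++ ys) (length xs + n) ≡ at d ys n
  at-++ʳ d []       n = refl
  at-++ʳ d (x ∷ xs) n = at-++ʳ d xs n

  at-ext : ∀ (d : A) xs ys → length xs ≡ length ys →
           (∀ r → r < length xs → at d xs r ≡ at d ys r) → xs ≡ ys
  at-ext d []       []       _   _  = refl
  at-ext d (x ∷ xs) (y ∷ ys) len eq =
    cong₂ _∷_ (eq 0 (s≤s z≤n))
              (at-ext d xs ys (suc-injective len) (λ r r<l → eq (suc r) (s≤s r<l)))

  at-applyUpTo : ∀ (d : A) f {n j} → j < n → at d (applyUpTo f n) j ≡ f j
  at-applyUpTo d f {suc n} {zero}  _         = refl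
  at-applyUpTo d f {suc n} {suc j} (s≤s j<n) = at-applyUpTo d (λ j → f (suc j)) j<n

  applyUpTo-cong : ∀ {f g : ℕ → A} n → (∀ j → j < n → f j ≡ g j) →
                   applyUpTo f n ≡ applyUpTo g n
  applyUpTo-cong zero    _  = refl
  applyUpTo-cong (suc n) eq =
    cong₂ _∷_ (eq 0 (s≤s z≤n)) (applyUpTo-cong n (λ j j<n → eq (suc j) (s≤s j<n)))

  factor : (ℕ → A) → ℕ → ℕ → List A
  factor w i = applyUpTo (λ j → w (i + j))

  Agree : ℕ → (ℕ → A) → ℕ → (ℕ → A) → ℕ → Set
  Agree n w i w′ i′ = ∀ j → j < n → w (i + j) ≡ w′ (i′ + j)

  agree? : DecidableEquality A → ∀ n w i w′ i′ → Dec (Agree n w i w′ i′)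
  agree? _≟_ n w i w′ i′ = below? (λ j → w (i + j) ≟ w′ (i′ + j)) n

  transfer-period : ∀ {n m ℓ} w i w′ i′ → ℓ + m ≤ n → Agree n w i w′ i′ →
                    Agree m w i w (i + ℓ) → Agree m w′ i′ w′ (i′ + ℓ)
  transfer-period {n} {m} {ℓ} w i w′ i′ ℓ+m≤n agree periodic j j<m = begin
    w′ (i′ + j)        ≡⟨ agree j (<-≤-trans j<m (≤-trans (m≤n+m m ℓ) ℓ+m≤n)) ⟨
    w (i + j)          ≡⟨ periodic j j<m ⟩
    w (i + ℓ + j)      ≡⟨ cong w (+-assoc i ℓ j) ⟩
    w (i + (ℓ + j))    ≡⟨ agree (ℓ + j) (<-≤-trans (+-monoʳ-< ℓ j<m) ℓ+m≤n) ⟩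
    w′ (i′ + (ℓ + j))  ≡⟨ cong w′ (+-assoc i′ ℓ j) ⟨
    w′ (i′ + ℓ + j)    ∎
    where open ≡-Reasoning

  -- Unlike squares, near-squares survive desubstitution, which may lose the
  -- last, partially covered block.
  NearSquareAt : (ℕ → A) → ℕ → ℕ → Set
  NearSquareAt w i ℓ = Agree (pred ℓ) w i w (i + ℓ)

  square⇒nearSquare : ∀ w i {ℓ} → SquareAt w i ℓ → NearSquareAt w i ℓ
  square⇒nearSquare w i square j j<ℓ-1 = square j (<-≤-trans j<ℓ-1 pred[n]≤n)

next-multiple : ∀ k .{{_ : NonZero k}} i → ∃[ i′ ] ∃[ e ] e < k × i′ * k ≡ e + i
next-multiple k zero = 0 , 0 , >-nonZero⁻¹ k , refl
next-multiple k (suc i) with next-multiple k i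
... | i′ , suc e , e<k , i′k≡ = i′ , e , <-trans (n<1+n e) e<k , trans i′k≡ (sym (+-suc e i))
... | i′ , zero  , _   , i′k≡ = suc i′ , pred k , subst (pred k <_) (suc-pred k) ≤-refl , step
  where
  open ≡-Reasoning
  step : suc i′ * k ≡ pred k + suc i
  step = begin
    k + i′ * k        ≡⟨ cong (k +_) i′k≡ ⟩
    k + i             ≡⟨ cong (_+ i) (suc-pred k) ⟨
    suc (pred k + i)  ≡⟨ +-suc (pred k) i ⟨
    pred k + suc i    ∎

window-fits : ∀ {k} K {r n} → r < k → n + k ≤ suc (K * k) → r + n ≤ K * k
window-fits {k} K {r} {n} r<k fits = s≤s⁻¹ (begin
  suc r + n    ≤⟨ +-monoˡ-≤ n r<k ⟩
  k + n        ≡⟨ +-comm k n ⟩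
  n + k        ≤⟨ fits ⟩
  suc (K * k)  ∎)
  where open ≤-Reasoning

near-square-bound : ∀ {k e r j m} → e < k → r < k → j < pred m → e + (r + j * k) < pred (m * k)
near-square-bound {k} {e} {r} {j} {suc m} e<k r<k j<m = pred-mono-≤ (begin
  suc (suc (e + (r + j * k)))  ≡⟨ cong suc (+-suc e (r + j * k)) ⟨
  suc e + (suc r + j * k)      ≤⟨ +-mono-≤ e<k (+-monoˡ-≤ (j * k) r<k) ⟩
  suc (suc j) * k              ≤⟨ *-monoˡ-≤ k (s≤s j<m) ⟩
  suc m * k                    ∎)
  where open ≤-Reasoning

-- The default letter b₀ of `at` is irrelevant: every lookup below is within range.
module UniformMorphism {A B : Set} (b₀ : B) {k : ℕ} .{{_ : NonZero k}}
                       (f : A → List B) (f-uniform : ∀ a → length (f a) ≡ k) where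

  length-concatMap : ∀ xs → length (concatMap f xs) ≡ length xs * k
  length-concatMap []       = refl
  length-concatMap (x ∷ xs) =
    trans (length-++ (f x)) (cong₂ _+_ (f-uniform x) (length-concatMap xs))

  at-concatMap : ∀ (a₀ : A) xs {q r} → r < k → q < length xs →
                 at b₀ (concatMap f xs) (r + q * k) ≡ at b₀ (f (at a₀ xs q)) r
  at-concatMap a₀ (x ∷ xs) {zero} {r} r<k _ =
    trans (cong (at b₀ (f x ++ concatMap f xs)) (+-identityʳ r))
          (at-++ˡ b₀ (f x) (subst (r <_) (sym (f-uniform x)) r<k))
  at-concatMap a₀ (x ∷ xs) {suc q} {r} r<k (s≤s q<l) = begin
    at b₀ (f x ++ concatMap f xs) (r + suc q * k)
      ≡⟨ cong (at b₀ (f x ++ concatMap f xs)) skip ⟩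
    at b₀ (f x ++ concatMap f xs) (length (f x) + (r + q * k))
      ≡⟨ at-++ʳ b₀ (f x) (r + q * k) ⟩
    at b₀ (concatMap f xs) (r + q * k)
      ≡⟨ at-concatMap a₀ xs r<k q<l ⟩
    at b₀ (f (at a₀ xs q)) r
      ∎
    where
    open ≡-Reasoning
    skip : r + suc q * k ≡ length (f x) + (r + q * k)
    skip = begin
      r + suc q * k               ≡⟨ solve (r ∷ q ∷ k ∷ []) ⟩
      k + (r + q * k)             ≡⟨ cong (_+ (r + q * k)) (f-uniform x) ⟨
      length (f x) + (r + q * k)  ∎

  record IsImage (v : ℕ → A) (w : ℕ → B) : Set where
    field block : ∀ q r → r < k → w (r + q * k) ≡ at b₀ (f (v q)) r

  image-window : ∀ {v w} → IsImage v w → ∀ K {n} q r → r + n ≤ K * k →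
                 Agree n w (r + q * k) (at b₀ (concatMap f (factor v q K))) r
  image-window {v} {w} image K q r fits j j<n = begin
    w (r + q * k + j)                        ≡⟨ cong w regroup ⟩
    w (s + (q + t) * k)                      ≡⟨ IsImage.block image (q + t) s s<k ⟩
    at b₀ (f (v (q + t))) s                  ≡⟨ cong (λ a → at b₀ (f a) s) (at-applyUpTo _ _ t<K) ⟨
    at b₀ (f (at (v q) (factor v q K) t)) s  ≡⟨ at-concatMap (v q) (factor v q K) s<k t<length ⟨
    at b₀ u (s + t * k)                      ≡⟨ cong (at b₀ u) r+j≡s+t*k ⟨
    at b₀ u (r + j)                          ∎
    where
    open ≡-Reasoning
    u = concatMap f (factor v q K)
    s = (r + j) % k
    t = (r + j) / k
    s<k = m%n<n (r + j) k
    r+j≡s+t*k : r + j ≡ s + t * k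
    r+j≡s+t*k = m≡m%n+[m/n]*n (r + j) k
    regroup : r + q * k + j ≡ s + (q + t) * k
    regroup = begin
      r + q * k + j        ≡⟨ solve (r ∷ q ∷ k ∷ j ∷ []) ⟩
      r + j + q * k        ≡⟨ cong (_+ q * k) r+j≡s+t*k ⟩
      s + t * k + q * k    ≡⟨ +-assoc s (t * k) (q * k) ⟩
      s + (t * k + q * k)  ≡⟨ cong (s +_) (+-comm (t * k) (q * k)) ⟩
      s + (q * k + t * k)  ≡⟨ cong (s +_) (*-distribʳ-+ k q t) ⟨
      s + (q + t) * k      ∎
    t<K : t < K
    t<K = *-cancelʳ-< k t K (≤-<-trans (m≤n+m (t * k) s)
            (subst (_< K * k) r+j≡s+t*k (<-≤-trans (+-monoʳ-< r j<n) fits)))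
    t<length : t < length (factor v q K)
    t<length = subst (t <_) (sym (length-applyUpTo _ K)) t<K

  window : ∀ {v w} → IsImage v w → ∀ K {n} → n + k ≤ suc (K * k) →
           ∀ p → Agree n w p (at b₀ (concatMap f (factor v (p / k) K))) (p % k)
  window {v} {w} image K {n} fits p =
    subst (λ i → Agree n w i (at b₀ (concatMap f (factor v (p / k) K))) (p % k))
          (sym (m≡m%n+[m/n]*n p k))
          (image-window image K (p / k) (p % k) (window-fits K (m%n<n p k) fits))

  -- Cut at the first block boundary i′ * k = e + i at or after i: the blocks i′ + j and
  -- i′ + m + j then sit at the same offsets in the two halves, and f is injective.
  desubstitute : ∀ {v w} → IsImage v w → Injective _≡_ _≡_ f →
                 ∀ i m → NearSquareAt w i (m * k) → ∃[ i′ ] NearSquareAt v i′ m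
  desubstitute {v} {w} image f-injective i m near with next-multiple k i
  ... | i′ , e , e<k , i′k≡e+i = i′ , λ j j<m →
    f-injective (at-ext b₀ _ _ (trans (f-uniform _) (sym (f-uniform _)))
                   (λ r r<l → blocks-agree j j<m r (subst (r <_) (f-uniform _) r<l)))
    where
    open ≡-Reasoning
    open IsImage image
    blocks-agree : ∀ j → j < pred m → ∀ r → r < k →
                   at b₀ (f (v (i′ + j))) r ≡ at b₀ (f (v (i′ + m + j))) r
    blocks-agree j j<m r r<k = begin
      at b₀ (f (v (i′ + j))) r             ≡⟨ block (i′ + j) r r<k ⟨
      w (r + (i′ + j) * k)                 ≡⟨ cong w (begin
        r + (i′ + j) * k                     ≡⟨ solve (r ∷ i′ ∷ j ∷ k ∷ []) ⟩
        i′ * k + (r + j * k)                 ≡⟨ cong (_+ (r + j * k)) i′k≡e+i ⟩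
        e + i + (r + j * k)                  ≡⟨ solve (e ∷ i ∷ r ∷ j ∷ k ∷ []) ⟩
        i + (e + (r + j * k))                ∎) ⟩
      w (i + (e + (r + j * k)))            ≡⟨ near _ (near-square-bound {m = m} e<k r<k j<m) ⟩
      w (i + m * k + (e + (r + j * k)))    ≡⟨ cong w (begin
        i + m * k + (e + (r + j * k))        ≡⟨ solve (i ∷ m ∷ k ∷ e ∷ r ∷ j ∷ []) ⟩
        e + i + (r + (m + j) * k)            ≡⟨ cong (_+ (r + (m + j) * k)) i′k≡e+i ⟨
        i′ * k + (r + (m + j) * k)           ≡⟨ solve (i′ ∷ k ∷ r ∷ m ∷ j ∷ []) ⟩
        r + (i′ + m + j) * k                 ∎) ⟩
      w (r + (i′ + m + j) * k)             ≡⟨ block (i′ + m + j) r r<k ⟩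
      at b₀ (f (v (i′ + m + j))) r         ∎

  record Synchronizing (L : ℕ) (w : ℕ → B) : Set where
    field same-phase : ∀ i i′ → Agree L w i w i′ → i % k ≡ i′ % k

  synchronized-period : ∀ {L w} → Synchronizing L w →
                        ∀ {m} i ℓ → L ≤ m → Agree m w i w (i + ℓ) → k ∣ ℓ
  synchronized-period sync i ℓ L≤m agree =
    ∣m+n∣m⇒∣n (divides ((i + ℓ) / k) shift) (n∣m*n (i / k))
    where
    open ≡-Reasoning
    same-phase : i % k ≡ (i + ℓ) % k
    same-phase = Synchronizing.same-phase sync i (i + ℓ) λ j j<L → agree j (<-≤-trans j<L L≤m)
    shift : i / k * k + ℓ ≡ (i + ℓ) / k * k
    shift = +-cancelˡ-≡ (i % k) _ _ (begin
      i % k + (i / k * k + ℓ)        ≡⟨ +-assoc (i % k) (i / k * k) ℓ ⟨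
      i % k + i / k * k + ℓ          ≡⟨ cong (_+ ℓ) (m≡m%n+[m/n]*n i k) ⟨
      i + ℓ                          ≡⟨ m≡m%n+[m/n]*n (i + ℓ) k ⟩
      (i + ℓ) % k + (i + ℓ) / k * k  ≡⟨ cong (_+ (i + ℓ) / k * k) same-phase ⟨
      i % k + (i + ℓ) / k * k        ∎)

  PhaseDetermining : ℕ → List (List A) → Set
  PhaseDetermining L S = All (λ u → All (λ u′ → ∀ r → r < k → ∀ r′ → r′ < k →
    Agree L (at b₀ (concatMap f u)) r (at b₀ (concatMap f u′)) r′ → r ≡ r′) S) S

  phaseDetermining? : DecidableEquality B → ∀ L S → Dec (PhaseDetermining L S)
  phaseDetermining? _≟_ L S = All.all? (λ u → All.all? (λ u′ →
    below? (λ r → below? (λ r′ →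
      agree? _≟_ L (at b₀ (concatMap f u)) r (at b₀ (concatMap f u′)) r′ →-dec r ℕ.≟ r′) k) k) S) S

  module Windows {v w} (image : IsImage v w) {K} {S : List (List A)}
                 (covered : ∀ q → factor v q K ∈ S) where

    windows-synchronize : ∀ {L} → L + k ≤ suc (K * k) → PhaseDetermining L S →
                          Synchronizing L w
    windows-synchronize fits determining = record { same-phase = λ i i′ agree →
      All.lookup (All.lookup determining (covered (i / k))) (covered (i′ / k))
        (i % k) (m%n<n i k) (i′ % k) (m%n<n i′ k)
        λ j j<L → trans (sym (window image K fits i j j<L))
                        (trans (agree j j<L) (window image K fits i′ j j<L)) }

    windows-exclude-period : ∀ {n m ℓ} → n + k ≤ suc (K * k) → ℓ + m ≤ n →
      All (λ u → ∀ r → r < k → ¬ Agree m (at b₀ (concatMap f u)) r (at b₀ (concatMap f u)) (r + ℓ)) S →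
      ∀ i → ¬ Agree m w i w (i + ℓ)
    windows-exclude-period fits ℓ+m≤n excluded i periodic =
      All.lookup excluded (covered (i / k)) (i % k) (m%n<n i k)
        (transfer-period w i (at b₀ (concatMap f (factor v (i / k) K))) (i % k) ℓ+m≤n
                         (window image K fits i) periodic)

module FixedPoint {A : Set} (a₀ : A) {k} .{{_ : NonZero k}}
                  (f : A → List A) (f-uniform : ∀ a → length (f a) ≡ k) where

  open UniformMorphism a₀ f f-uniform public

  factors-closed : 1 < k → ∀ {v} → IsImage v v → ∀ {K S} → K + k ≤ suc (K * k) →
                   factor v 0 K ∈ S → All (λ u → ∀ r → r < k → factor (at a₀ (concatMap f u)) r K ∈ S) S →
                   ∀ p → factor v p K ∈ S
  factors-closed 1<k {v} image {K} {S} fits base closed = <-rec _ step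
    where
    step : ∀ p → (∀ {q} → q < p → factor v q K ∈ S) → factor v p K ∈ S
    step zero      _  = base
    step p@(suc _) ih = subst (_∈ S) (sym (applyUpTo-cong K (window image K fits p)))
                          (All.lookup closed (ih (m/n<m p k 1<k)) (p % k) (m%n<n p k))

hL-uniform : ∀ a → length (hL a) ≡ 3
hL-uniform = from-yes (uniform? hL 3)

hL-injective : Injective _≡_ _≡_ hL
hL-injective = from-yes (injective? (≡-dec Fin._≟_) hL)

module H = FixedPoint a0 hL hL-uniform

hIter-extends : ∀ n → ∃[ t ] hIter (suc n) ≡ hIter n ++ t
hIter-extends zero    = a1 ∷ a2 ∷ [] , refl
hIter-extends (suc n) with hIter-extends n
... | t , eq = concatMap hL t , trans (cong (concatMap hL) eq) (concatMap-++ hL (hIter n) t)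

n<length-hIter : ∀ n → n < length (hIter n)
n<length-hIter zero    = s≤s z≤n
n<length-hIter (suc n) = subst (suc n <_) (sym (H.length-concatMap (hIter n)))
  (≤-<-trans n<l (m<m*n l 3 {{>-nonZero (≤-<-trans z≤n n<l)}} (s≤s (s≤s z≤n))))
  where
  l = length (hIter n)
  n<l = n<length-hIter n

hω-hIter : ∀ {q n} → q < n → at a0 (hIter n) q ≡ hω q
hω-hIter {q} {suc n} q<1+n with m<1+n⇒m<n∨m≡n q<1+n | hIter-extends n
... | inj₂ refl  | _      = refl
... | inj₁ q<n   | t , eq = begin
  at a0 (hIter (suc n)) q   ≡⟨ cong (λ xs → at a0 xs q) eq ⟩
  at a0 (hIter n ++ t) q    ≡⟨ at-++ˡ a0 (hIter n) (<-trans q<n (n<length-hIter n)) ⟩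
  at a0 (hIter n) q         ≡⟨ hω-hIter q<n ⟩
  hω q                      ∎
  where open ≡-Reasoning

at-morph-hIter : ∀ {B : Set} (b₀ : B) g → (∀ a → length (g a) ≡ 3) →
                 ∀ {n} q {r} → r < 3 → q ≤ n →
                 at b₀ (morph g (hIter (suc n))) (r + q * 3) ≡ at b₀ (g (hω q)) r
at-morph-hIter b₀ g g-uniform {n} q {r} r<3 q≤n = begin
  at b₀ (morph g (hIter (suc n))) (r + q * 3)  ≡⟨ at-concatMap a0 (hIter (suc n)) r<3 q<length ⟩
  at b₀ (g (at a0 (hIter (suc n)) q)) r        ≡⟨ cong (λ a → at b₀ (g a) r) (hω-hIter (s≤s q≤n)) ⟩
  at b₀ (g (hω q)) r                           ∎
  where
  open ≡-Reasoning
  open UniformMorphism b₀ g g-uniform using (at-concatMap)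
  q<length = <-trans (s≤s q≤n) (n<length-hIter (suc n))

q≤r+q*3 : ∀ q r → q ≤ r + q * 3
q≤r+q*3 q r = ≤-trans (m≤m*n q 3) (m≤n+m (q * 3) r)

hω-image : H.IsImage hω hω
hω-image = record { block = λ q r r<3 →
  trans (sym (hω-hIter (m<n⇒m<1+n (n<1+n (r + q * 3)))))
        (at-morph-hIter a0 hL hL-uniform q r<3 (q≤r+q*3 q r)) }

gImage-image : ∀ g (g-uniform : ∀ a → length (g a) ≡ 3) →
               UniformMorphism.IsImage b0 g g-uniform hω (gImage g)
gImage-image g g-uniform =
  record { block = λ q r r<3 → at-morph-hIter b0 g g-uniform q r<3 (q≤r+q*3 q r) }

factors₆ : List (List Σ₄)
factors₆ =
    (a0 ∷ a1 ∷ a2 ∷ a0 ∷ a3 ∷ a1 ∷ [])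
  ∷ (a0 ∷ a1 ∷ a2 ∷ a3 ∷ a0 ∷ a2 ∷ [])
  ∷ (a0 ∷ a1 ∷ a2 ∷ a3 ∷ a2 ∷ a1 ∷ [])
  ∷ (a0 ∷ a2 ∷ a0 ∷ a1 ∷ a2 ∷ a3 ∷ [])
  ∷ (a0 ∷ a2 ∷ a0 ∷ a3 ∷ a1 ∷ a0 ∷ [])
  ∷ (a0 ∷ a2 ∷ a0 ∷ a3 ∷ a1 ∷ a3 ∷ [])
  ∷ (a0 ∷ a2 ∷ a3 ∷ a2 ∷ a1 ∷ a0 ∷ [])
  ∷ (a0 ∷ a3 ∷ a1 ∷ a0 ∷ a1 ∷ a2 ∷ [])
  ∷ (a0 ∷ a3 ∷ a1 ∷ a3 ∷ a0 ∷ a2 ∷ [])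
  ∷ (a0 ∷ a3 ∷ a1 ∷ a3 ∷ a2 ∷ a1 ∷ [])
  ∷ (a1 ∷ a0 ∷ a1 ∷ a2 ∷ a0 ∷ a3 ∷ [])
  ∷ (a1 ∷ a0 ∷ a1 ∷ a2 ∷ a3 ∷ a0 ∷ [])
  ∷ (a1 ∷ a0 ∷ a1 ∷ a2 ∷ a3 ∷ a2 ∷ [])
  ∷ (a1 ∷ a0 ∷ a3 ∷ a1 ∷ a3 ∷ a0 ∷ [])
  ∷ (a1 ∷ a2 ∷ a0 ∷ a3 ∷ a1 ∷ a0 ∷ [])
  ∷ (a1 ∷ a2 ∷ a0 ∷ a3 ∷ a1 ∷ a3 ∷ [])
  ∷ (a1 ∷ a2 ∷ a3 ∷ a0 ∷ a2 ∷ a0 ∷ [])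
  ∷ (a1 ∷ a2 ∷ a3 ∷ a2 ∷ a1 ∷ a3 ∷ [])
  ∷ (a1 ∷ a3 ∷ a0 ∷ a2 ∷ a0 ∷ a1 ∷ [])
  ∷ (a1 ∷ a3 ∷ a0 ∷ a2 ∷ a3 ∷ a2 ∷ [])
  ∷ (a1 ∷ a3 ∷ a2 ∷ a1 ∷ a0 ∷ a1 ∷ [])
  ∷ (a1 ∷ a3 ∷ a2 ∷ a1 ∷ a0 ∷ a3 ∷ [])
  ∷ (a2 ∷ a0 ∷ a1 ∷ a2 ∷ a3 ∷ a0 ∷ [])
  ∷ (a2 ∷ a0 ∷ a1 ∷ a2 ∷ a3 ∷ a2 ∷ [])
  ∷ (a2 ∷ a0 ∷ a3 ∷ a1 ∷ a0 ∷ a1 ∷ [])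
  ∷ (a2 ∷ a0 ∷ a3 ∷ a1 ∷ a3 ∷ a2 ∷ [])
  ∷ (a2 ∷ a1 ∷ a0 ∷ a1 ∷ a2 ∷ a0 ∷ [])
  ∷ (a2 ∷ a1 ∷ a0 ∷ a3 ∷ a1 ∷ a3 ∷ [])
  ∷ (a2 ∷ a1 ∷ a3 ∷ a0 ∷ a2 ∷ a0 ∷ [])
  ∷ (a2 ∷ a1 ∷ a3 ∷ a0 ∷ a2 ∷ a3 ∷ [])
  ∷ (a2 ∷ a3 ∷ a0 ∷ a2 ∷ a0 ∷ a3 ∷ [])
  ∷ (a2 ∷ a3 ∷ a2 ∷ a1 ∷ a0 ∷ a1 ∷ [])
  ∷ (a2 ∷ a3 ∷ a2 ∷ a1 ∷ a0 ∷ a3 ∷ [])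
  ∷ (a2 ∷ a3 ∷ a2 ∷ a1 ∷ a3 ∷ a0 ∷ [])
  ∷ (a3 ∷ a0 ∷ a2 ∷ a0 ∷ a1 ∷ a2 ∷ [])
  ∷ (a3 ∷ a0 ∷ a2 ∷ a0 ∷ a3 ∷ a1 ∷ [])
  ∷ (a3 ∷ a0 ∷ a2 ∷ a3 ∷ a2 ∷ a1 ∷ [])
  ∷ (a3 ∷ a1 ∷ a0 ∷ a1 ∷ a2 ∷ a3 ∷ [])
  ∷ (a3 ∷ a1 ∷ a3 ∷ a0 ∷ a2 ∷ a0 ∷ [])
  ∷ (a3 ∷ a1 ∷ a3 ∷ a0 ∷ a2 ∷ a3 ∷ [])
  ∷ (a3 ∷ a1 ∷ a3 ∷ a2 ∷ a1 ∷ a0 ∷ [])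
  ∷ (a3 ∷ a2 ∷ a1 ∷ a0 ∷ a1 ∷ a2 ∷ [])
  ∷ (a3 ∷ a2 ∷ a1 ∷ a0 ∷ a3 ∷ a1 ∷ [])
  ∷ (a3 ∷ a2 ∷ a1 ∷ a3 ∷ a0 ∷ a2 ∷ [])
  ∷ []

open DecMembership (≡-dec (Fin._≟_ {4})) using (_∈?_)

opaque
  hω-factors : ∀ p → factor hω p 6 ∈ factors₆
  hω-factors = H.factors-closed (s≤s (s≤s z≤n)) hω-image (from-yes (9 ℕ.≤? 19))
    (from-yes (factor hω 0 6 ∈? factors₆))
    (from-yes (All.all? (λ u → below? (λ r →
      factor (at a0 (concatMap hL u)) r 6 ∈? factors₆) 3) factors₆))

module Hω = H.Windows hω-image hω-factors

opaque
  hω-synchronizing : H.Synchronizing 2 hω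
  hω-synchronizing =
    Hω.windows-synchronize (from-yes (5 ℕ.≤? 19)) (from-yes (H.phaseDetermining? Fin._≟_ 2 factors₆))

  hω-windows-nearSquareFree : All (λ u → ∀ r → r < 3 → ∀ ℓ → ℓ < 9 → 3 ≤ ℓ →
                                         ¬ NearSquareAt (at a0 (concatMap hL u)) r ℓ) factors₆
  hω-windows-nearSquareFree = from-yes (All.all? (λ u → below? (λ r → below? (λ ℓ →
    3 ℕ.≤? ℓ →-dec ¬? (agree? Fin._≟_ (pred ℓ) (at a0 (concatMap hL u)) r (at a0 (concatMap hL u)) (r + ℓ)))
    9) 3) factors₆)

short-period-fits : ∀ {ℓ m} → ℓ < 9 → m ≤ ℓ → ℓ + m ≤ 16
short-period-fits ℓ<9 m≤ℓ = +-mono-≤ (s≤s⁻¹ ℓ<9) (≤-trans m≤ℓ (s≤s⁻¹ ℓ<9))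

hω-short-nearSquareFree : ∀ i {ℓ} → 3 ≤ ℓ → ℓ < 9 → ¬ NearSquareAt hω i ℓ
hω-short-nearSquareFree i {ℓ} 3≤ℓ ℓ<9 =
  Hω.windows-exclude-period {16} {pred ℓ} {ℓ} (from-yes (19 ℕ.≤? 19)) (short-period-fits ℓ<9 pred[n]≤n)
    (All.map (λ excluded r r<3 → excluded r r<3 ℓ ℓ<9 3≤ℓ) hω-windows-nearSquareFree) i

hω-nearSquareFree : ∀ ℓ i → 3 ≤ ℓ → ¬ NearSquareAt hω i ℓ
hω-nearSquareFree = <-rec _ step
  where
  NoNearSquareOfPeriod : ℕ → Set
  NoNearSquareOfPeriod ℓ = ∀ i → 3 ≤ ℓ → ¬ NearSquareAt hω i ℓ

  step : ∀ ℓ → (∀ {m} → m < ℓ → NoNearSquareOfPeriod m) → NoNearSquareOfPeriod ℓ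
  step ℓ ih i 3≤ℓ near with ℓ ℕ.<? 9
  ... | yes ℓ<9 = hω-short-nearSquareFree i 3≤ℓ ℓ<9 near
  ... | no ℓ≮9 with H.synchronized-period hω-synchronizing i ℓ (pred-mono-≤ 3≤ℓ) near
  ...   | divides m refl with H.desubstitute hω-image hL-injective i m near
  ...     | i′ , near′ = ih m<m*3 i′ 3≤m near′
    where
    3≤m : 3 ≤ m
    3≤m = *-cancelʳ-≤ 3 m 3 (≮⇒≥ ℓ≮9)
    m<m*3 : m < m * 3
    m<m*3 = m<m*n m 3 {{>-nonZero (<-≤-trans (s≤s z≤n) 3≤m)}} (s≤s (s≤s z≤n))

WindowsShortSquareFree : (Σ₄ → List Bin) → Set
WindowsShortSquareFree g =
  All (λ u → ∀ r → r < 3 → ∀ ℓ → ℓ < 9 → 4 ≤ ℓ → ¬ SquareAt (at b0 (concatMap g u)) r ℓ)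
      factors₆

windowsShortSquareFree? : ∀ g → Dec (WindowsShortSquareFree g)
windowsShortSquareFree? g = All.all? (λ u → below? (λ r → below? (λ ℓ →
  4 ℕ.≤? ℓ →-dec ¬? (agree? Fin._≟_ ℓ (at b0 (concatMap g u)) r (at b0 (concatMap g u)) (r + ℓ)))
  9) 3) factors₆

module Coding (g : Σ₄ → List Bin) (g-uniform : ∀ a → length (g a) ≡ 3)
              (g-injective : Injective _≡_ _≡_ g)
              (phases : UniformMorphism.PhaseDetermining b0 g g-uniform 9 factors₆)
              (short : WindowsShortSquareFree g) where

  open UniformMorphism b0 g g-uniform

  g-image : IsImage hω (gImage g)
  g-image = gImage-image g g-uniform

  open Windows g-image hω-factors

  short-squareFree : ∀ i {ℓ} → 4 ≤ ℓ → ℓ < 9 → ¬ SquareAt (gImage g) i ℓ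
  short-squareFree i {ℓ} 4≤ℓ ℓ<9 =
    windows-exclude-period {16} {ℓ} {ℓ} (from-yes (19 ℕ.≤? 19)) (short-period-fits ℓ<9 ≤-refl)
      (All.map (λ excluded r r<3 → excluded r r<3 ℓ ℓ<9 4≤ℓ) short) i

  g-synchronizing : Synchronizing 9 (gImage g)
  g-synchronizing = windows-synchronize (from-yes (12 ℕ.≤? 19)) phases

  long-squareFree : ∀ i {ℓ} → 9 ≤ ℓ → ¬ SquareAt (gImage g) i ℓ
  long-squareFree i {ℓ} 9≤ℓ square with synchronized-period g-synchronizing i ℓ 9≤ℓ square
  ... | divides m refl with desubstitute g-image g-injective i m (square⇒nearSquare (gImage g) i square)
  ... | i′ , near = hω-nearSquareFree m i′ (*-cancelʳ-≤ 3 m 3 9≤ℓ) near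

  longSquareFree : ¬ HasLongSquare (gImage g)
  longSquareFree (i , ℓ , 4≤ℓ , square) with ℓ ℕ.<? 9
  ... | yes ℓ<9 = short-squareFree i 4≤ℓ ℓ<9 square
  ... | no ℓ≮9  = long-squareFree i (≮⇒≥ ℓ≮9) square

g₁-uniform : ∀ a → length (g₁L a) ≡ 3
g₁-uniform = from-yes (uniform? g₁L 3)

g₂-uniform : ∀ a → length (g₂L a) ≡ 3
g₂-uniform = from-yes (uniform? g₂L 3)

lemma18 : ¬ HasLongSquare (gImage g₁L) × ¬ HasLongSquare (gImage g₂L)
lemma18 =
  Coding.longSquareFree g₁L g₁-uniform (from-yes (injective? (≡-dec Fin._≟_) g₁L))
    (from-yes (UniformMorphism.phaseDetermining? b0 g₁L g₁-uniform Fin._≟_ 9 factors₆))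
    (from-yes (windowsShortSquareFree? g₁L)) ,
  Coding.longSquareFree g₂L g₂-uniform (from-yes (injective? (≡-dec Fin._≟_) g₂L))
    (from-yes (UniformMorphism.phaseDetermining? b0 g₂L g₂-uniform Fin._≟_ 9 factors₆))
    (from-yes (windowsShortSquareFree? g₂L))
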